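{- $P_5\le B$.
   Context: All graphs are finite and simple, considered up to isomorphism. An edge-colored graph is a pair $(G,c)$ with $c\colon E(G)\to\mathbb{N}$ an arbitrary map (not necessarily proper); it is colored in $t$ or more colors if $|c(E(G))|\ge t$. A subgraph (not necessarily induced) is rainbow if its edges receive pairwise distinct colors. $(G,c)$ is rainbow $H$-free if $G$ contains no rainbow subgraph isomorphic to $H$. For graphs $H_1,H_2$, write $H_1\le H_2$ if there is a positive integer $t$ such that every rainbow $H_1$-free edge-colored complete graph colored in $t$ or more colors is rainbow $H_2$-free. $P_5$ is the path on $5$ vertices. The barbell $B$ is the unique tree with degree sequence $(3,3,1,1,1,1)$: two adjacent vertices, each adjacent to two further leaves. -}

module Defs where

open import Data.Nat using (ℕ; _≤_)
open import Data.Fin using (Fin; zero; suc)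
open import Data.Product using (Σ; _×_; _,_; proj₁; proj₂)
open import Relation.Binary.PropositionalEquality using (_≡_; _≢_)
open import Relation.Nullary using (¬_)
open import Function.Definitions using (Injective)

-- A finite simple graph given by its vertex set Fin vertices and an
-- enumeration of its (pairwise distinct, non-loop) edges.
record Graph : Set where
  field
    vertices : ℕ
    nedges   : ℕ
    edge     : Fin nedges → Fin vertices × Fin vertices

-- An edge-colored complete graph K_n: a symmetric colour assignment to
-- the pairs of distinct vertices (values on the diagonal are irrelevant).
record ColoredKn (n : ℕ) : Set where
  field
    col : Fin n → Fin n → ℕ
    sym : ∀ i j → col i j ≡ col j i

open ColoredKn public

ColoredInAtLeast : ∀ {n} → ColoredKn n → ℕ → Set
ColoredInAtLeast {n} c t =
  Σ (Fin t → Fin n × Fin n) λ e →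
    (∀ i → proj₁ (e i) ≢ proj₂ (e i)) ×
    (∀ i j → col c (proj₁ (e i)) (proj₂ (e i)) ≡ col c (proj₁ (e j)) (proj₂ (e j)) → i ≡ j)

HasRainbow : Graph → ∀ {n} → ColoredKn n → Set
HasRainbow H {n} c =
  Σ (Fin (Graph.vertices H) → Fin n) λ f →
    Injective _≡_ _≡_ f ×
    (∀ i j → col c (f (proj₁ (Graph.edge H i))) (f (proj₂ (Graph.edge H i)))
           ≡ col c (f (proj₁ (Graph.edge H j))) (f (proj₂ (Graph.edge H j))) → i ≡ j)

RainbowFree : Graph → ∀ {n} → ColoredKn n → Set
RainbowFree H c = ¬ HasRainbow H c

_≼_ : Graph → Graph → Set
H₁ ≼ H₂ = Σ ℕ λ t → (1 ≤ t) ×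
  (∀ n (c : ColoredKn n) → ColoredInAtLeast c t → RainbowFree H₁ c → RainbowFree H₂ c)

P5 : Graph
P5 = record { vertices = 5 ; nedges = 4 ; edge = e }
  where
  e : Fin 4 → Fin 5 × Fin 5
  e zero = zero , suc zero
  e (suc zero) = suc zero , suc (suc zero)
  e (suc (suc zero)) = suc (suc zero) , suc (suc (suc zero))
  e (suc (suc (suc zero))) = suc (suc (suc zero)) , suc (suc (suc (suc zero)))

-- Barbell: centres 0,1 adjacent; 0 adjacent to leaves 2,3; 1 to leaves 4,5.
B : Graph
B = record { vertices = 6 ; nedges = 5 ; edge = e }
  where
  e : Fin 5 → Fin 6 × Fin 6
  e zero = zero , suc zero
  e (suc zero) = zero , suc (suc zero)
  e (suc (suc zero)) = zero , suc (suc (suc zero))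
  e (suc (suc (suc zero))) = suc zero , suc (suc (suc (suc zero)))
  e (suc (suc (suc (suc zero)))) = suc zero , suc (suc (suc (suc (suc zero))))

{-# OPTIONS --safe #-}
module Submission where

open import Defs
open import Data.Nat using (ℕ; s≤s; z≤n; _≟_)
open import Data.Fin using (Fin; zero; suc)
open import Data.Fin.Patterns using (0F; 1F; 2F; 3F; 4F; 5F)
open import Data.Fin.Properties using (any?)
open import Data.List using (List; _∷_; []; map; tabulate; lookup)
open import Data.List.Relation.Binary.Pointwise using ([]; _∷_; Pointwise-≡⇒≡)
open import Data.List.Relation.Unary.All using (universal)
open import Data.List.Relation.Unary.AllPairs using (_∷_)
import Data.List.Relation.Unary.All.Properties as All
open import Data.List.Relation.Unary.Unique.Propositional using (Unique)
open import Data.List.Relation.Unary.Unique.Propositional.Properties using (map⁺)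
import Data.List.Relation.Unary.Unique.DecPropositional as DecUnique
open import Data.Product using (_,_)
open import Data.Sum using (_⊎_; inj₁; inj₂)
open import Function using (_∘_)
open import Function.Definitions using (Injective)
open import Relation.Binary.PropositionalEquality using (_≡_; refl; cong; subst; ≢-sym)
open import Relation.Nullary using (yes; no; contradiction)
open import Relation.Nullary.Decidable using (True; toWitness)

open module FinUnique {m} = DecUnique (Data.Fin._≟_ {m}) using (unique?)

-- Let u, v be the centres of a rainbow barbell, a, b the leaves at u and x, y the leaves at v,
-- and z the colour of the chord ax. Each of the paths a x v u b, x a u v y and u a x v y
-- consists of ax and three barbell edges, and every barbell edge is missed by one of them.
-- So if z is a new colour the first path is rainbow, and if z is the colour of a barbell
-- edge, a path missing that edge is rainbow.

tabulate⁻ : ∀ {a} {A : Set a} {m} {f : Fin m → A} {i j} →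
            Unique (tabulate f) → f i ≡ f j → i ≡ j
tabulate⁻ {i = zero}  {zero}  _         _  = refl
tabulate⁻ {i = zero}  {suc j} (f₀≢ ∷ _) eq = contradiction eq (All.tabulate⁻ f₀≢ j)
tabulate⁻ {i = suc i} {zero}  (f₀≢ ∷ _) eq = contradiction eq (≢-sym (All.tabulate⁻ f₀≢ i))
tabulate⁻ {i = suc i} {suc j} (_ ∷ u)   eq = cong suc (tabulate⁻ u eq)

distinct-image : ∀ {a} {A : Set a} {m} {f : Fin m → A} → Injective _≡_ _≡_ f →
                 (ks : List (Fin m)) → {True (unique? ks)} → Unique (map f ks)
distinct-image f-inj _ {ks-distinct} = map⁺ f-inj (toWitness ks-distinct)

rainbow-path⇒HasRainbow-P5 : ∀ {n} (c : ColoredKn n) {p q r s t : Fin n} →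
  Unique (p ∷ q ∷ r ∷ s ∷ t ∷ []) →
  Unique (col c p q ∷ col c q r ∷ col c r s ∷ col c s t ∷ []) →
  HasRainbow P5 c
rainbow-path⇒HasRainbow-P5 c {p} {q} {r} {s} {t} vertices colours =
  lookup (p ∷ q ∷ r ∷ s ∷ t ∷ []) , tabulate⁻ vertices , λ _ _ → tabulate⁻ colours

-- With the vertices 0F, …, 5F of B named u, v, a, b, x, y, κ lists the colours of the
-- barbell edges uv, ua, ub, vx, vy, and z is the colour of ax.
some-path-colours-unique : ∀ {κ : Fin 5 → ℕ} → Injective _≡_ _≡_ κ → ∀ z →
  Unique (z ∷ κ 3F ∷ κ 0F ∷ κ 2F ∷ []) ⊎
  Unique (z ∷ κ 1F ∷ κ 0F ∷ κ 4F ∷ []) ⊎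
  Unique (κ 1F ∷ z ∷ κ 3F ∷ κ 4F ∷ [])
some-path-colours-unique {κ} κ-inj z with any? (λ k → z ≟ κ k)
... | no new = inj₁ (All.map⁺ (universal (λ k → new ∘ (k ,_)) _)
                     ∷ distinct-image κ-inj (3F ∷ 0F ∷ 2F ∷ []))
... | yes (0F , refl) = inj₂ (inj₂ (distinct-image κ-inj (1F ∷ 0F ∷ 3F ∷ 4F ∷ [])))
... | yes (1F , refl) = inj₁ (distinct-image κ-inj (1F ∷ 3F ∷ 0F ∷ 2F ∷ []))
... | yes (2F , refl) = inj₂ (inj₁ (distinct-image κ-inj (2F ∷ 1F ∷ 0F ∷ 4F ∷ [])))
... | yes (3F , refl) = inj₂ (inj₁ (distinct-image κ-inj (3F ∷ 1F ∷ 0F ∷ 4F ∷ [])))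
... | yes (4F , refl) = inj₁ (distinct-image κ-inj (4F ∷ 3F ∷ 0F ∷ 2F ∷ []))

HasRainbow-B⇒HasRainbow-P5 : ∀ {n} (c : ColoredKn n) → HasRainbow B c → HasRainbow P5 c
HasRainbow-B⇒HasRainbow-P5 c (g , g-inj , rainbow)
  with some-path-colours-unique (λ {i} {j} → rainbow i j) (col c (g 2F) (g 4F))
... | inj₁ colours = rainbow-path⇒HasRainbow-P5 c
        (distinct-image g-inj (2F ∷ 4F ∷ 1F ∷ 0F ∷ 3F ∷ []))
        (subst Unique (Pointwise-≡⇒≡ (refl ∷ sym c _ _ ∷ sym c _ _ ∷ refl ∷ [])) colours)
... | inj₂ (inj₁ colours) = rainbow-path⇒HasRainbow-P5 c
        (distinct-image g-inj (4F ∷ 2F ∷ 0F ∷ 1F ∷ 5F ∷ []))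
        (subst Unique (Pointwise-≡⇒≡ (sym c _ _ ∷ sym c _ _ ∷ refl ∷ refl ∷ [])) colours)
... | inj₂ (inj₂ colours) = rainbow-path⇒HasRainbow-P5 c
        (distinct-image g-inj (0F ∷ 2F ∷ 4F ∷ 1F ∷ 5F ∷ []))
        (subst Unique (Pointwise-≡⇒≡ (refl ∷ refl ∷ sym c _ _ ∷ refl ∷ [])) colours)

lemma18 : P5 ≼ B
lemma18 = 1 , s≤s z≤n , λ n c _ P5-free → P5-free ∘ HasRainbow-B⇒HasRainbow-P5 c
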